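{- Let $V$ be a finite-dimensional vector space over $\mathrm{GF}(q)$ and $K_1\le U\le K_2\le V$ a chain of subspaces. For each subspace $T\le V$, \[\{K\in K_1 *_U K_2/U : T\le K\}=\begin{cases}(K_1+T) *_{U+T} K_2/(U+T) & \text{if } U\cap T\le K_1 \text{ and } T\le K_2,\\ \emptyset & \text{otherwise.}\end{cases}\] Moreover, setting $u=\dim(U)$, $k_1=\dim(K_1)$, $\bar k_2=\dim(K_2/U)$ and $r=\dim((U+T)/U)$, \[\lambda(T,K_1 *_U K_2/U)=\begin{cases} q^{(u-k_1)(\bar k_2-r)} & \text{if } U\cap T\le K_1\text{ and } T\le K_2,\\ 0&\text{otherwise.}\end{cases}\]
   Context: For subspaces $K_1\le U\le K_2\le V$, the ordinary join is $K_1 *_U K_2/U=\{K\le V: U\cap K=K_1,\ U+K=K_2\}$. For a set $\mathcal{B}$ of subspaces of $V$ and $T\le V$, $\lambda(T,\mathcal{B})=\#\{B\in\mathcal{B}: T\le B\}$. -}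

module Defs where

open import Data.Nat using (ℕ; zero; suc)
open import Data.Bool using (Bool; true; false; _∧_; _∨_; not; _xor_)
open import Data.List using (List; []; _∷_; _++_; map; concatMap; length; filterᵇ)
open import Data.Bool.ListAction using (all; any)
open import Data.List.Membership.Propositional using (_∈_)
open import Data.List.Relation.Unary.Unique.Propositional using (Unique)
open import Data.Vec using (Vec; []; _∷_; zipWith; replicate)
import Data.Vec as Vec
open import Data.Vec.Properties using (≡-dec)
open import Data.Fin using (Fin)
open import Data.Product using (Σ; _×_; ∃)
open import Relation.Binary.PropositionalEquality using (_≡_; _≢_)
open import Relation.Binary.Definitions using (DecidableEquality)
open import Relation.Nullary.Decidable using (⌊_⌋)
open import Algebra.Structures using (IsCommutativeRing)

record FiniteField : Set₁ where
  field
    Carrier : Set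
    _+_ _*_ : Carrier → Carrier → Carrier
    -_ : Carrier → Carrier
    0# 1# : Carrier
    isCommutativeRing : IsCommutativeRing _≡_ _+_ _*_ -_ 0# 1#
    0≢1 : 0# ≢ 1#
    inverse : ∀ x → x ≢ 0# → ∃ λ y → x * y ≡ 1#
    _≟_ : DecidableEquality Carrier
    elements : List Carrier
    complete : ∀ x → x ∈ elements
    unique : Unique elements

  order : ℕ
  order = length elements

module _ (F : FiniteField) where
  open FiniteField F

  Vect : ℕ → Set
  Vect n = Vec Carrier n

  0v : ∀ {n} → Vect n
  0v = replicate _ 0#

  _+v_ : ∀ {n} → Vect n → Vect n → Vect n
  _+v_ = zipWith _+_

  _·v_ : ∀ {n} → Carrier → Vect n → Vect n
  c ·v x = Vec.map (c *_) x

  _≟v_ : ∀ {n} → DecidableEquality (Vect n)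
  _≟v_ = ≡-dec _≟_

  enumV : (n : ℕ) → List (Vect n)
  enumV zero = [] ∷ []
  enumV (suc n) = concatMap (λ a → map (a ∷_) (enumV n)) elements

  Subset : ℕ → Set
  Subset n = Vect n → Bool

  module _ {n : ℕ} where
    allV : (Vect n → Bool) → Bool
    allV p = all p (enumV n)

    anyV : (Vect n → Bool) → Bool
    anyV p = any p (enumV n)

    _⊆_ : Subset n → Subset n → Bool
    A ⊆ B = allV (λ x → not (A x) ∨ B x)

    _≐_ : Subset n → Subset n → Bool
    A ≐ B = allV (λ x → not (A x xor B x))

    _∩_ : Subset n → Subset n → Subset n
    (A ∩ B) x = A x ∧ B x

    _⊕_ : Subset n → Subset n → Subset n
    (A ⊕ B) x = anyV (λ a → anyV (λ b → A a ∧ (B b ∧ ⌊ x ≟v (a +v b) ⌋)))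

    isSubspace : Subset n → Bool
    isSubspace S = S 0v ∧ (allV (λ x → allV (λ y → not (S x ∧ S y) ∨ S (x +v y)))
                       ∧ all (λ c → allV (λ x → not (S x) ∨ S (c ·v x))) elements)

    -- K ∈ K₁ *_U K₂ / U  :  K ≤ V, U ∩ K = K₁, U + K = K₂
    inJoin : Subset n → Subset n → Subset n → Subset n → Bool
    inJoin K₁ U K₂ K = isSubspace K ∧ (((U ∩ K) ≐ K₁) ∧ ((U ⊕ K) ≐ K₂))

  sublists : ∀ {A : Set} → List A → List (List A)
  sublists [] = [] ∷ []
  sublists (x ∷ xs) = sublists xs ++ map (x ∷_) (sublists xs)

  -- all subsets of V, each exactly once
  allSubsets : (n : ℕ) → List (Subset n)
  allSubsets n = map (λ S x → any (λ y → ⌊ x ≟v y ⌋) S) (sublists (enumV n))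

  join : ∀ {n} → Subset n → Subset n → Subset n → List (Subset n)
  join {n} K₁ U K₂ = filterᵇ (inJoin K₁ U K₂) (allSubsets n)

  lam : ∀ {n} → Subset n → List (Subset n) → ℕ
  lam T ℬ = length (filterᵇ (λ B → T ⊆ B) ℬ)

  lincomb : ∀ {n d} → Vec Carrier d → Vec (Vect n) d → Vect n
  lincomb [] [] = 0v
  lincomb (c ∷ cs) (v ∷ vs) = (c ·v v) +v lincomb cs vs

  HasDim : ∀ {n} → Subset n → ℕ → Set
  HasDim {n} S d = Σ (Vec (Vect n) d) λ b →
      (∀ (i : Fin d) → S (Vec.lookup b i) ≡ true)
    × (∀ (c : Vec Carrier d) → lincomb c b ≡ 0v → c ≡ replicate d 0#)
    × (∀ x → S x ≡ true → ∃ λ (c : Vec Carrier d) → x ≡ lincomb c b)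

-- A member K of K₁ *_U K₂ containing T forces U ∩ T ≤ U ∩ K = K₁ and T ≤ K ≤ K₂; conversely,
-- the modular law W ∩ (A + T) = A + (W ∩ T) for A ≤ W moves T across the defining equations
-- U ∩ K = K₁ and U + K = K₂, which identifies these K with the join (K₁ + T) *_(U+T) K₂.
--
-- To count a join A *_W B, fix a basis x of W modulo A and a basis y of B modulo W, of sizes c
-- and e. Each member K contains exactly one vector yⱼ + Σᵢ Mⱼᵢ xᵢ for every j, and K is
-- A + span{yⱼ + Σᵢ Mⱼᵢ xᵢ}; so K ↦ M is a bijection onto the e × c matrices (K/A is the graph of
-- the linear map B/W → W/A with matrix M), and the join has q^(ce) members. For A = K₁ + T,
-- W = U + T, B = K₂, a basis of U modulo K₁ stays a basis of U + T modulo K₁ + T since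
-- U ∩ T ≤ K₁, so c = u − k₁, while e = (u + k̄₂) − (u + r). Dimension is well defined because an
-- injection GF(q)^d → GF(q)^m forces q^d ≤ q^m.

module Submission where

open import Defs
open import Data.Nat using (ℕ; zero; suc; _+_; _*_; _∸_; _^_; _≤_; _<_)
import Data.Nat.Properties as ℕ
open import Data.Bool using (Bool; true; false; _∧_; _∨_; not; _xor_; if_then_else_)
open import Data.Bool.ListAction using (all; any)
open import Data.List using (List; []; _∷_; length; map; concatMap; filterᵇ; lookup)
import Data.List.Properties as List
open import Data.List.Relation.Unary.Any as Any using (Any; here; there)
import Data.List.Relation.Unary.Any.Properties as Any
open import Data.List.Relation.Unary.All as All using (All)
open import Data.List.Relation.Unary.AllPairs as AllPairs using (AllPairs; []; _∷_)
import Data.List.Relation.Unary.AllPairs.Properties as AllPairs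
open import Data.List.Membership.Propositional using (_∈_; _∉_)
open import Data.List.Membership.Propositional.Properties
  using (∈-lookup; ∈-map⁺; ∈-map⁻; ∈-concatMap⁺; ∈-++⁺ˡ; ∈-++⁺ʳ; ∈-++⁻)
open import Data.Vec as Vec using (Vec; []; _∷_; _++_)
import Data.Vec.Properties as Vecₚ
import Data.Vec.Relation.Unary.All as VecAll
import Data.Vec.Relation.Unary.All.Properties as VecAll
open import Data.Fin using (Fin; zero; suc)
import Data.Fin.Properties as Fin
open import Data.Product using (Σ; _×_; _,_; proj₁; proj₂; map₁)
open import Data.Sum using (inj₁; inj₂)
open import Data.Empty using (⊥-elim)
open import Relation.Nullary using (¬_; Dec; yes; no; contradiction)
open import Relation.Nullary.Decidable using (T?; ⌊_⌋; dec-true; isYes≗does)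
open import Relation.Binary.Structures using (IsEquivalence)
open import Relation.Binary.Bundles using (Setoid)
open import Relation.Binary.PropositionalEquality
open import Function using (_∘_)
open import Function.Bundles using (_⇔_; mk⇔; Equivalence)
open import Algebra.Bundles using (AbelianGroup; Ring)
open import Algebra.Structures using (IsCommutativeRing; IsAbelianGroup)
import Algebra.Properties.AbelianGroup as AbelianGroupProperties
import Algebra.Properties.CommutativeSemigroup as CommutativeSemigroupProperties
import Algebra.Properties.Ring as RingProperties

private variable
  A B : Set

∧-true⁻ : ∀ {a b} → a ∧ b ≡ true → a ≡ true × b ≡ true
∧-true⁻ {true} {true} _ = refl , refl

∧-true⁺ : ∀ {a b} → a ≡ true → b ≡ true → a ∧ b ≡ true
∧-true⁺ refl refl = refl

true-ext : ∀ {a b} → (a ≡ true → b ≡ true) → (b ≡ true → a ≡ true) → a ≡ b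
true-ext {false} {false} _ _ = refl
true-ext {false} {true}  _ g = g refl
true-ext {true}  {false} f _ = sym (f refl)
true-ext {true}  {true}  _ _ = refl

all-true⁻ : ∀ (p : A → Bool) xs → all p xs ≡ true → ∀ {x} → x ∈ xs → p x ≡ true
all-true⁻ p (y ∷ ys) e (here refl) = proj₁ (∧-true⁻ e)
all-true⁻ p (y ∷ ys) e (there x∈) = all-true⁻ p ys (proj₂ (∧-true⁻ e)) x∈

all-true⁺ : ∀ (p : A → Bool) xs → (∀ {x} → x ∈ xs → p x ≡ true) → all p xs ≡ true
all-true⁺ p []       h = refl
all-true⁺ p (y ∷ ys) h = ∧-true⁺ (h (here refl)) (all-true⁺ p ys (h ∘ there))

any-true⁻ : ∀ (p : A → Bool) xs → any p xs ≡ true → Σ A λ x → x ∈ xs × p x ≡ true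
any-true⁻ p (y ∷ ys) e with p y in py
... | true  = y , here refl , py
... | false = let x , x∈ , px = any-true⁻ p ys e in x , there x∈ , px

any-true⁺ : ∀ (p : A → Bool) xs {x} → x ∈ xs → p x ≡ true → any p xs ≡ true
any-true⁺ p (y ∷ ys) (here refl) px rewrite px = refl
any-true⁺ p (y ∷ ys) (there x∈) px with p y
... | true  = refl
... | false = any-true⁺ p ys x∈ px

∈-filterᵇ⁻ : ∀ (p : A → Bool) xs {x} → x ∈ filterᵇ p xs → x ∈ xs × p x ≡ true
∈-filterᵇ⁻ p (y ∷ ys) x∈ with p y in py
∈-filterᵇ⁻ p (y ∷ ys) (here refl) | true = here refl , py
∈-filterᵇ⁻ p (y ∷ ys) (there x∈) | true = map₁ there (∈-filterᵇ⁻ p ys x∈)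
... | false = map₁ there (∈-filterᵇ⁻ p ys x∈)

∈-filterᵇ⁺ : ∀ (p : A → Bool) xs {x} → x ∈ xs → p x ≡ true → x ∈ filterᵇ p xs
∈-filterᵇ⁺ p (y ∷ ys) (here refl) px rewrite px = here refl
∈-filterᵇ⁺ p (y ∷ ys) (there x∈) px with p y
... | true  = there (∈-filterᵇ⁺ p ys x∈ px)
... | false = ∈-filterᵇ⁺ p ys x∈ px

filterᵇ-cong : ∀ {p q : A → Bool} xs → p ≗ q → filterᵇ p xs ≡ filterᵇ q xs
filterᵇ-cong []       _ = refl
filterᵇ-cong {q = q} (y ∷ ys) h rewrite h y with q y
... | true  = cong (y ∷_) (filterᵇ-cong ys h)
... | false = filterᵇ-cong ys h

filterᵇ-filterᵇ : ∀ (p q : A → Bool) xs →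
                  filterᵇ q (filterᵇ p xs) ≡ filterᵇ (λ x → p x ∧ q x) xs
filterᵇ-filterᵇ p q []       = refl
filterᵇ-filterᵇ p q (y ∷ ys) with p y
... | false = filterᵇ-filterᵇ p q ys
... | true with q y
...   | true  = cong (y ∷_) (filterᵇ-filterᵇ p q ys)
...   | false = filterᵇ-filterᵇ p q ys

filterᵇ-false : ∀ (xs : List A) → filterᵇ (λ _ → false) xs ≡ []
filterᵇ-false []       = refl
filterᵇ-false (_ ∷ xs) = filterᵇ-false xs

lookup-injective : ∀ {R : A → A → Set} → (∀ {a b} → R a b → R b a) →
                   ∀ xs → AllPairs (λ a b → ¬ R a b) xs →
                   ∀ i j → R (lookup xs i) (lookup xs j) → i ≡ j
lookup-injective sym (x ∷ xs) (_ ∷ _)   zero    zero    r = refl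
lookup-injective sym (x ∷ xs) (x≁ ∷ _)  zero    (suc j) r = ⊥-elim (All.lookup x≁ (∈-lookup j) r)
lookup-injective sym (x ∷ xs) (x≁ ∷ _)  (suc i) zero    r = ⊥-elim (All.lookup x≁ (∈-lookup i) (sym r))
lookup-injective sym (x ∷ xs) (_ ∷ xs≁) (suc i) (suc j) r = cong suc (lookup-injective sym xs xs≁ i j r)

length-≤-by-injection : ∀ (xs : List A) (ys : List B) (R : A → B → Set) →
  (∀ i → Any (R (lookup xs i)) ys) →
  (∀ i j y → R (lookup xs i) y → R (lookup xs j) y → i ≡ j) →
  length xs ≤ length ys
length-≤-by-injection xs ys R related injective = Fin.injective⇒≤ {f = index} index-injective
  where
  index : Fin (length xs) → Fin (length ys)
  index i = Any.index (related i)
  index-injective : ∀ {i j} → index i ≡ index j → i ≡ j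
  index-injective {i} {j} e = injective i j _ (Any.lookup-index (related i))
    (subst (λ k → R (lookup xs j) (lookup ys k)) (sym e) (Any.lookup-index (related j)))

module _ {_≈_ : A → A → Set} (≈-equiv : IsEquivalence _≈_) where
  private module ≈ = IsEquivalence ≈-equiv

  length-≡-by-inverses : ∀ (xs : List A) (ys : List B) →
    AllPairs (λ a a' → ¬ a ≈ a') xs → AllPairs _≢_ ys →
    (f : A → B) (g : B → A) → (∀ {a a'} → a ≈ a' → f a ≡ f a') →
    (∀ {a} → a ∈ xs → f a ∈ ys) → (∀ {b} → b ∈ ys → Σ A λ a → a ∈ xs × g b ≈ a) →
    (∀ b → f (g b) ≡ b) → (∀ {a} → a ∈ xs → a ≈ g (f a)) →
    length xs ≡ length ys
  length-≡-by-inverses xs ys xs≉ ys≢ f g f-cong f∈ g∈ fg gf = ℕ.≤-antisym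
    (length-≤-by-injection xs ys (λ a b → f a ≡ b)
      (λ i → f∈ (∈-lookup i))
      (λ i j b fi fj → lookup-injective ≈.sym xs xs≉ i j
        (≈.trans (gf (∈-lookup i)) (subst (λ b′ → g b′ ≈ lookup xs j)
          (trans fj (sym fi)) (≈.sym (gf (∈-lookup j)))))))
    (length-≤-by-injection ys xs (λ b a → g b ≈ a)
      (λ i → let a , a∈ , ga = g∈ (∈-lookup i) in Any.map (λ { refl → ga }) a∈)
      (λ i j a gi gj → lookup-injective sym ys ys≢ i j
        (trans (sym (fg _)) (trans (f-cong (≈.trans gi (≈.sym gj))) (fg _)))))

⌊⌋-true⁻ : ∀ {P : Set} (p? : Dec P) → ⌊ p? ⌋ ≡ true → P
⌊⌋-true⁻ (yes p) _ = p

⌊⌋-true⁺ : ∀ {P : Set} (p? : Dec P) → P → ⌊ p? ⌋ ≡ true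
⌊⌋-true⁺ p? p = trans (isYes≗does p?) (dec-true p? p)

^-cancelˡ-≤ : ∀ q {d m} → 1 < q → q ^ d ≤ q ^ m → d ≤ m
^-cancelˡ-≤ q {d} {m} 1<q q^d≤q^m with ℕ.≤-<-connex d m
... | inj₁ d≤m = d≤m
... | inj₂ m<d = contradiction q^d≤q^m (ℕ.<⇒≱ (ℕ.^-monoʳ-< q 1<q m<d))

first : (A → Bool) → A → List A → A
first p d []       = d
first p d (a ∷ as) = if p a then a else first p d as

first-satisfies : ∀ (p : A → Bool) d xs {a} → a ∈ xs → p a ≡ true → p (first p d xs) ≡ true
first-satisfies p d (b ∷ xs) a∈ pa with p b in pb
... | true = pb
first-satisfies p d (b ∷ xs) (here refl) pa | false with () ← trans (sym pa) pb
first-satisfies p d (b ∷ xs) (there a∈) pa | false = first-satisfies p d xs a∈ pa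

first-cong : ∀ {p q : A → Bool} d xs → p ≗ q → first p d xs ≡ first q d xs
first-cong d []       _ = refl
first-cong {q = q} d (b ∷ xs) h rewrite h b with q b
... | true  = refl
... | false = first-cong d xs h

vecs : List A → (d : ℕ) → List (Vec A d)
vecs xs zero    = [] ∷ []
vecs xs (suc d) = concatMap (λ a → map (a ∷_) (vecs xs d)) xs

∈-vecs : ∀ (xs : List A) → (∀ a → a ∈ xs) → ∀ {d} (v : Vec A d) → v ∈ vecs xs d
∈-vecs xs complete []      = here refl
∈-vecs xs complete (a ∷ v) = ∈-concatMap⁺ _
  (Any.map (λ { refl → ∈-map⁺ (a ∷_) (∈-vecs xs complete v) }) (complete a))

length-vecs : ∀ (xs : List A) d → length (vecs xs d) ≡ length xs ^ d
length-vecs xs zero    = refl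
length-vecs xs (suc d) = trans (length-rows xs) (cong (length xs *_) (length-vecs xs d))
  where
  length-rows : ∀ ys → length (concatMap (λ a → map (a ∷_) (vecs xs d)) ys)
                       ≡ length ys * length (vecs xs d)
  length-rows []       = refl
  length-rows (y ∷ ys) = trans (List.length-++ (map (y ∷_) (vecs xs d)))
    (cong₂ _+_ (List.length-map (y ∷_) (vecs xs d)) (length-rows ys))

vecs-distinct : ∀ (xs : List A) → AllPairs _≢_ xs → ∀ d → AllPairs _≢_ (vecs xs d)
vecs-distinct xs xs≢ zero    = All.[] ∷ []
vecs-distinct xs xs≢ (suc d) = rows xs xs≢
  where
  head∈ : ∀ ys {w} → w ∈ concatMap (λ a → map (a ∷_) (vecs xs d)) ys → Vec.head w ∈ ys
  head∈ (y ∷ ys) w∈ with ∈-++⁻ (map (y ∷_) (vecs xs d)) w∈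
  ... | inj₁ w∈ʸ with ∈-map⁻ (y ∷_) w∈ʸ
  ...   | _ , _ , refl = here refl
  head∈ (y ∷ ys) w∈ | inj₂ w∈ʸˢ = there (head∈ ys w∈ʸˢ)
  rows : ∀ ys → AllPairs _≢_ ys → AllPairs _≢_ (concatMap (λ a → map (a ∷_) (vecs xs d)) ys)
  rows []       []          = []
  rows (y ∷ ys) (y≢ ∷ ys≢) = AllPairs.++⁺
    (AllPairs.map⁺ (AllPairs.map (λ v≢ e → v≢ (cong Vec.tail e)) (vecs-distinct xs xs≢ d)))
    (rows ys ys≢)
    (All.tabulate λ w∈ → All.tabulate λ w′∈ e →
      let _ , _ , w≡ = ∈-map⁻ (y ∷_) w∈ in
      All.lookup y≢ (head∈ ys w′∈) (trans (sym (cong Vec.head w≡)) (cong Vec.head e)))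

AllPairs-map-∈ : ∀ {R R′ : A → A → Set} (xs : List A) →
                 (∀ {s s′} → s ∈ xs → s′ ∈ xs → R s s′ → R′ s s′) → AllPairs R xs → AllPairs R′ xs
AllPairs-map-∈ []       f []         = []
AllPairs-map-∈ (x ∷ xs) f (x~ ∷ xs~) =
  All.tabulate (λ s′∈ → f (here refl) (there s′∈) (All.lookup x~ s′∈)) ∷
  AllPairs-map-∈ xs (λ s∈ s′∈ → f (there s∈) (there s′∈)) xs~

module Vectors (F : FiniteField) where
  open FiniteField F renaming (_+_ to _+F_; _*_ to _*F_; -_ to -F_)
  open IsCommutativeRing isCommutativeRing
    using (+-assoc; +-comm; +-identityˡ; +-identityʳ; -‿inverseˡ; -‿inverseʳ;
           distribˡ; distribʳ; *-assoc; *-identityˡ; zeroˡ; zeroʳ; isRing)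

  private
    ring : Ring _ _
    ring = record { isRing = isRing }

  infixl 6 _+ᵥ_ _-ᵥ_
  infixr 7 _·ᵥ_

  _+ᵥ_ : ∀ {n} → Vect F n → Vect F n → Vect F n
  _+ᵥ_ = _+v_ F

  _·ᵥ_ : ∀ {n} → Carrier → Vect F n → Vect F n
  _·ᵥ_ = _·v_ F

  0ᵥ : ∀ {n} → Vect F n
  0ᵥ = 0v F

  negᵥ : ∀ {n} → Vect F n → Vect F n
  negᵥ = Vec.map -F_

  _-ᵥ_ : ∀ {n} → Vect F n → Vect F n → Vect F n
  x -ᵥ y = x +ᵥ negᵥ y

  +ᵥ-isAbelianGroup : ∀ {n} → IsAbelianGroup _≡_ (_+ᵥ_ {n}) 0ᵥ negᵥ
  +ᵥ-isAbelianGroup = record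
    { isGroup = record
      { isMonoid = record
        { isSemigroup = record
          { isMagma = record { isEquivalence = isEquivalence ; ∙-cong = cong₂ _+ᵥ_ }
          ; assoc = Vecₚ.zipWith-assoc +-assoc }
        ; identity = Vecₚ.zipWith-identityˡ +-identityˡ , Vecₚ.zipWith-identityʳ +-identityʳ }
      ; inverse = Vecₚ.zipWith-inverseˡ -‿inverseˡ , Vecₚ.zipWith-inverseʳ -‿inverseʳ
      ; ⁻¹-cong = cong negᵥ }
    ; comm = Vecₚ.zipWith-comm +-comm }

  +ᵥ-abelianGroup : ℕ → AbelianGroup _ _
  +ᵥ-abelianGroup n = record { isAbelianGroup = +ᵥ-isAbelianGroup {n} }

  module _ {n : ℕ} where
    open AbelianGroup (+ᵥ-abelianGroup n) public
      using () renaming (assoc to +ᵥ-assoc; comm to +ᵥ-comm;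
                         identityˡ to +ᵥ-identityˡ; identityʳ to +ᵥ-identityʳ;
                         inverseʳ to negᵥ-inverseʳ)
    open AbelianGroupProperties (+ᵥ-abelianGroup n) public
      using (inverseʳ-unique; x∙y⁻¹≈ε⇒x≈y; ⁻¹-∙-comm)
      renaming (//-rightDividesʳ to +ᵥ--ᵥ-cancel)
    open CommutativeSemigroupProperties
      (AbelianGroup.commutativeSemigroup (+ᵥ-abelianGroup n)) public
      using () renaming (interchange to +ᵥ-interchange; xy∙z≈xz∙y to +ᵥ-comm-middle)

  ·ᵥ-distribˡ : ∀ {n} c (x y : Vect F n) → c ·ᵥ (x +ᵥ y) ≡ c ·ᵥ x +ᵥ c ·ᵥ y
  ·ᵥ-distribˡ c []      []      = refl
  ·ᵥ-distribˡ c (a ∷ x) (b ∷ y) = cong₂ _∷_ (distribˡ c a b) (·ᵥ-distribˡ c x y)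

  ·ᵥ-distribʳ : ∀ {n} a b (x : Vect F n) → (a +F b) ·ᵥ x ≡ a ·ᵥ x +ᵥ b ·ᵥ x
  ·ᵥ-distribʳ a b []      = refl
  ·ᵥ-distribʳ a b (c ∷ x) = cong₂ _∷_ (distribʳ c a b) (·ᵥ-distribʳ a b x)

  ·ᵥ-assoc : ∀ {n} a b (x : Vect F n) → (a *F b) ·ᵥ x ≡ a ·ᵥ b ·ᵥ x
  ·ᵥ-assoc a b []      = refl
  ·ᵥ-assoc a b (c ∷ x) = cong₂ _∷_ (*-assoc a b c) (·ᵥ-assoc a b x)

  ·ᵥ-identityˡ : ∀ {n} (x : Vect F n) → 1# ·ᵥ x ≡ x
  ·ᵥ-identityˡ []      = refl
  ·ᵥ-identityˡ (c ∷ x) = cong₂ _∷_ (*-identityˡ c) (·ᵥ-identityˡ x)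

  ·ᵥ-zeroˡ : ∀ {n} (x : Vect F n) → 0# ·ᵥ x ≡ 0ᵥ
  ·ᵥ-zeroˡ []      = refl
  ·ᵥ-zeroˡ (c ∷ x) = cong₂ _∷_ (zeroˡ c) (·ᵥ-zeroˡ x)

  ·ᵥ-zeroʳ : ∀ {n} c → c ·ᵥ 0ᵥ {n} ≡ 0ᵥ
  ·ᵥ-zeroʳ {zero}  c = refl
  ·ᵥ-zeroʳ {suc n} c = cong₂ _∷_ (zeroʳ c) (·ᵥ-zeroʳ c)

  negᵥ≡-1·ᵥ : ∀ {n} (x : Vect F n) → negᵥ x ≡ (-F 1#) ·ᵥ x
  negᵥ≡-1·ᵥ []      = refl
  negᵥ≡-1·ᵥ (a ∷ x) = cong₂ _∷_ (sym (RingProperties.-1*x≈-x ring a)) (negᵥ≡-1·ᵥ x)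

  +ᵥ--ᵥ-+ᵥ : ∀ {n} (a b b′ : Vect F n) → (a +ᵥ b) -ᵥ (a +ᵥ b′) ≡ b -ᵥ b′
  +ᵥ--ᵥ-+ᵥ a b b′ = begin
    (a +ᵥ b) +ᵥ negᵥ (a +ᵥ b′)          ≡⟨ cong ((a +ᵥ b) +ᵥ_) (sym (⁻¹-∙-comm a b′)) ⟩
    (a +ᵥ b) +ᵥ (negᵥ a +ᵥ negᵥ b′)     ≡⟨ +ᵥ-interchange a b _ _ ⟩
    (a -ᵥ a) +ᵥ (b -ᵥ b′)               ≡⟨ cong (_+ᵥ (b -ᵥ b′)) (negᵥ-inverseʳ a) ⟩
    0ᵥ +ᵥ (b -ᵥ b′)                     ≡⟨ +ᵥ-identityˡ _ ⟩
    b -ᵥ b′                             ∎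
    where open ≡-Reasoning

  lc : ∀ {n d} → Vec Carrier d → Vec (Vect F n) d → Vect F n
  lc = lincomb F

  lincomb-+ᵥ : ∀ {n d} (c c′ : Vect F d) (b : Vec (Vect F n) d) →
               lc (c +ᵥ c′) b ≡ lc c b +ᵥ lc c′ b
  lincomb-+ᵥ []      []        []      = sym (+ᵥ-identityˡ 0ᵥ)
  lincomb-+ᵥ (a ∷ c) (a′ ∷ c′) (v ∷ b) = begin
    (a +F a′) ·ᵥ v +ᵥ lc (c +ᵥ c′) b           ≡⟨ cong₂ _+ᵥ_ (·ᵥ-distribʳ a a′ v) (lincomb-+ᵥ c c′ b) ⟩
    (a ·ᵥ v +ᵥ a′ ·ᵥ v) +ᵥ (lc c b +ᵥ lc c′ b) ≡⟨ +ᵥ-interchange _ _ _ _ ⟩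
    (a ·ᵥ v +ᵥ lc c b) +ᵥ (a′ ·ᵥ v +ᵥ lc c′ b) ∎
    where open ≡-Reasoning

  lincomb-·ᵥ : ∀ {n d} a (c : Vect F d) (b : Vec (Vect F n) d) → lc (a ·ᵥ c) b ≡ a ·ᵥ lc c b
  lincomb-·ᵥ a []      []      = sym (·ᵥ-zeroʳ a)
  lincomb-·ᵥ a (x ∷ c) (v ∷ b) = trans (cong₂ _+ᵥ_ (·ᵥ-assoc a x v) (lincomb-·ᵥ a c b))
                                       (sym (·ᵥ-distribˡ a (x ·ᵥ v) (lc c b)))

  lincomb-0ᵥ : ∀ {n d} (b : Vec (Vect F n) d) → lc 0ᵥ b ≡ 0ᵥ
  lincomb-0ᵥ []      = refl
  lincomb-0ᵥ (v ∷ b) = trans (cong₂ _+ᵥ_ (·ᵥ-zeroˡ v) (lincomb-0ᵥ b)) (+ᵥ-identityˡ 0ᵥ)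

  lincomb-negᵥ : ∀ {n d} (c : Vect F d) (b : Vec (Vect F n) d) → lc (negᵥ c) b ≡ negᵥ (lc c b)
  lincomb-negᵥ c b = inverseʳ-unique (lc c b) (lc (negᵥ c) b)
    (trans (sym (lincomb-+ᵥ c (negᵥ c) b)) (trans (cong (λ z → lc z b) (negᵥ-inverseʳ c)) (lincomb-0ᵥ b)))

  lincomb--ᵥ : ∀ {n d} (c c′ : Vect F d) (b : Vec (Vect F n) d) →
                lc (c -ᵥ c′) b ≡ lc c b -ᵥ lc c′ b
  lincomb--ᵥ c c′ b = trans (lincomb-+ᵥ c (negᵥ c′) b) (cong (lc c b +ᵥ_) (lincomb-negᵥ c′ b))

  lincomb-++ : ∀ {n d e} (c : Vect F d) (c′ : Vect F e) (b : Vec (Vect F n) d) (b′ : Vec (Vect F n) e) →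
               lc (c ++ c′) (b ++ b′) ≡ lc c b +ᵥ lc c′ b′
  lincomb-++ []      c′ []      b′ = sym (+ᵥ-identityˡ _)
  lincomb-++ (a ∷ c) c′ (v ∷ b) b′ = trans (cong (a ·ᵥ v +ᵥ_) (lincomb-++ c c′ b b′)) (sym (+ᵥ-assoc _ _ _))

  lincomb-lincomb : ∀ {n c e} (p : Vect F e) (M : Vec (Vect F c) e) (x : Vec (Vect F n) c) →
                    lc (lc p M) x ≡ lc p (Vec.map (λ r → lc r x) M)
  lincomb-lincomb []      []      x = lincomb-0ᵥ x
  lincomb-lincomb (a ∷ p) (r ∷ M) x = trans (lincomb-+ᵥ (a ·ᵥ r) (lc p M) x)
    (cong₂ _+ᵥ_ (lincomb-·ᵥ a r x) (lincomb-lincomb p M x))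

  lincomb-zipWith : ∀ {n e} (p : Vect F e) (y w : Vec (Vect F n) e) →
                    lc p (Vec.zipWith _+ᵥ_ y w) ≡ lc p y +ᵥ lc p w
  lincomb-zipWith []      []      []      = sym (+ᵥ-identityˡ 0ᵥ)
  lincomb-zipWith (a ∷ p) (u ∷ y) (v ∷ w) =
    trans (cong₂ _+ᵥ_ (·ᵥ-distribˡ a u v) (lincomb-zipWith p y w)) (+ᵥ-interchange _ _ _ _)

  unit : ∀ {d} → Fin d → Vect F d
  unit zero    = 1# ∷ 0ᵥ
  unit (suc j) = 0# ∷ unit j

  lincomb-unit : ∀ {n d} (j : Fin d) (b : Vec (Vect F n) d) → lc (unit j) b ≡ Vec.lookup b j
  lincomb-unit zero    (v ∷ b) = trans (cong₂ _+ᵥ_ (·ᵥ-identityˡ v) (lincomb-0ᵥ b)) (+ᵥ-identityʳ v)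
  lincomb-unit (suc j) (v ∷ b) = trans (cong₂ _+ᵥ_ (·ᵥ-zeroˡ v) (lincomb-unit j b)) (+ᵥ-identityˡ _)

  LinearlyIndependent : ∀ {n d} → Vec (Vect F n) d → Set
  LinearlyIndependent b = ∀ c → lc c b ≡ 0ᵥ → c ≡ 0ᵥ

  lincomb-injective : ∀ {n d} (b : Vec (Vect F n) d) → LinearlyIndependent b →
                      ∀ c c′ → lc c b ≡ lc c′ b → c ≡ c′
  lincomb-injective b independent c c′ e = x∙y⁻¹≈ε⇒x≈y c c′ (independent (c -ᵥ c′)
    (trans (lincomb--ᵥ c c′ b) (trans (cong (_-ᵥ lc c′ b) e) (negᵥ-inverseʳ _))))

  0ᵥ++0ᵥ : ∀ d {e} → 0ᵥ {d} ++ 0ᵥ {e} ≡ 0ᵥ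
  0ᵥ++0ᵥ zero    = refl
  0ᵥ++0ᵥ (suc d) = cong (0# ∷_) (0ᵥ++0ᵥ d)

  enumV≡vecs : ∀ n → enumV F n ≡ vecs elements n
  enumV≡vecs zero    = refl
  enumV≡vecs (suc n) = cong (λ E → concatMap (λ a → map (a ∷_) E) elements) (enumV≡vecs n)

  ∈-enumV : ∀ {n} (x : Vect F n) → x ∈ enumV F n
  ∈-enumV {n} x = subst (x ∈_) (sym (enumV≡vecs n)) (∈-vecs elements complete x)

  length-enumV : ∀ n → length (enumV F n) ≡ order ^ n
  length-enumV n = trans (cong length (enumV≡vecs n)) (length-vecs elements n)

  enumV-distinct : ∀ n → AllPairs _≢_ (enumV F n)
  enumV-distinct n = subst (AllPairs _≢_) (sym (enumV≡vecs n)) (vecs-distinct elements unique n)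

  2≤order : 2 ≤ order
  2≤order = length-≤-by-injection (0# ∷ 1# ∷ []) elements _≡_ (λ _ → complete _)
    (λ i j _ e e′ → lookup-injective {R = _≡_} sym (0# ∷ 1# ∷ []) ((0≢1 All.∷ All.[]) ∷ All.[] ∷ []) i j
                      (trans e (sym e′)))

  injective⇒≤ : ∀ {d m} (g : Vect F d → Vect F m) → (∀ a b → g a ≡ g b → a ≡ b) → d ≤ m
  injective⇒≤ {d} {m} g injective = ^-cancelˡ-≤ order 2≤order
    (subst₂ _≤_ (length-enumV d) (length-enumV m)
      (length-≤-by-injection (enumV F d) (enumV F m) (λ a y → g a ≡ y) (λ _ → ∈-enumV _)
        (λ i j _ e e′ → lookup-injective sym (enumV F d) (enumV-distinct d) i j
                          (injective _ _ (trans e (sym e′))))))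

module Subspaces (F : FiniteField) where
  open FiniteField F using (Carrier; elements; complete)
  open Vectors F

  infix 4 _∋_ _⊑_

  _∋_ : ∀ {n} → Subset F n → Vect F n → Set
  S ∋ x = S x ≡ true

  _⊑_ : ∀ {n} → Subset F n → Subset F n → Set
  A ⊑ B = ∀ {x} → A ∋ x → B ∋ x

  module _ {n : ℕ} where

    allV-true⁻ : (p : Vect F n → Bool) → allV F p ≡ true → ∀ x → p x ≡ true
    allV-true⁻ p e x = all-true⁻ p (enumV F n) e (∈-enumV x)

    allV-true⁺ : (p : Vect F n → Bool) → (∀ x → p x ≡ true) → allV F p ≡ true
    allV-true⁺ p h = all-true⁺ p (enumV F n) (λ {x} _ → h x)

    anyV-true⁻ : (p : Vect F n → Bool) → anyV F p ≡ true → Σ (Vect F n) λ x → p x ≡ true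
    anyV-true⁻ p e = let x , _ , px = any-true⁻ p (enumV F n) e in x , px

    anyV-true⁺ : (p : Vect F n → Bool) → ∀ x → p x ≡ true → anyV F p ≡ true
    anyV-true⁺ p x px = any-true⁺ p (enumV F n) (∈-enumV x) px

    ⊆⇒⊑ : ∀ (A B : Subset F n) → _⊆_ F A B ≡ true → A ⊑ B
    ⊆⇒⊑ A B e {x} Ax = implication (allV-true⁻ _ e x)
      where
      implication : not (A x) ∨ B x ≡ true → B ∋ x
      implication rewrite Ax = λ Bx → Bx

    ⊑⇒⊆ : ∀ (A B : Subset F n) → A ⊑ B → _⊆_ F A B ≡ true
    ⊑⇒⊆ A B A⊑B = allV-true⁺ _ implication
      where
      implication : ∀ x → not (A x) ∨ B x ≡ true
      implication x with A x in Ax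
      ... | true  = A⊑B Ax
      ... | false = refl

    ≐⇒≗ : ∀ (A B : Subset F n) → _≐_ F A B ≡ true → A ≗ B
    ≐⇒≗ A B e x = xnor (A x) (B x) (allV-true⁻ _ e x)
      where
      xnor : ∀ a b → not (a xor b) ≡ true → a ≡ b
      xnor false false _ = refl
      xnor true  true  _ = refl

    ≗⇒≐ : ∀ (A B : Subset F n) → A ≗ B → _≐_ F A B ≡ true
    ≗⇒≐ A B h = allV-true⁺ _ λ x → xnor (A x) (h x)
      where
      xnor : ∀ a {b} → a ≡ b → not (a xor b) ≡ true
      xnor false refl = refl
      xnor true  refl = refl

    ⊑-antisym : ∀ {A B : Subset F n} → A ⊑ B → B ⊑ A → A ≗ B
    ⊑-antisym A⊑B B⊑A x = true-ext A⊑B B⊑A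

    ∩⁻ : ∀ (A B : Subset F n) {x} → _∩_ F A B ∋ x → A ∋ x × B ∋ x
    ∩⁻ A B {x} = ∧-true⁻ {A x}

    ∩⁺ : ∀ (A B : Subset F n) {x} → A ∋ x → B ∋ x → _∩_ F A B ∋ x
    ∩⁺ _ _ = ∧-true⁺

    ⊕⁻ : ∀ (A B : Subset F n) {x} → _⊕_ F A B ∋ x →
         Σ (Vect F n) λ a → Σ (Vect F n) λ b → A ∋ a × B ∋ b × x ≡ a +ᵥ b
    ⊕⁻ A B {x} e =
      let a , e′  = anyV-true⁻ _ e
          b , e″  = anyV-true⁻ _ e′
          Aa , e‴ = ∧-true⁻ {A a} e″
          Bb , x≟ = ∧-true⁻ {B b} e‴
      in a , b , Aa , Bb , ⌊⌋-true⁻ (_≟v_ F x (a +ᵥ b)) x≟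

    ⊕⁺ : ∀ (A B : Subset F n) {x a b} → A ∋ a → B ∋ b → x ≡ a +ᵥ b → _⊕_ F A B ∋ x
    ⊕⁺ A B {x} {a} {b} Aa Bb x≡ =
      anyV-true⁺ _ a (anyV-true⁺ _ b (∧-true⁺ Aa (∧-true⁺ Bb (⌊⌋-true⁺ (_≟v_ F x (a +ᵥ b)) x≡))))

  record Subspace {n} (S : Subset F n) : Set where
    field
      0∈ : S ∋ 0ᵥ
      +-closed : ∀ {x y} → S ∋ x → S ∋ y → S ∋ x +ᵥ y
      ·-closed : ∀ c {x} → S ∋ x → S ∋ c ·ᵥ x

    neg-closed : ∀ {x} → S ∋ x → S ∋ negᵥ x
    neg-closed {x} Sx = subst (S ∋_) (sym (negᵥ≡-1·ᵥ x)) (·-closed _ Sx)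

    -ᵥ-closed : ∀ {x y} → S ∋ x → S ∋ y → S ∋ x -ᵥ y
    -ᵥ-closed Sx Sy = +-closed Sx (neg-closed Sy)

    +-cancelʳ-closed : ∀ {x y} → S ∋ x +ᵥ y → S ∋ y → S ∋ x
    +-cancelʳ-closed {x} {y} Sx+y Sy = subst (S ∋_) (+ᵥ--ᵥ-cancel y x) (-ᵥ-closed Sx+y Sy)

    +-cancelˡ-closed : ∀ {x y} → S ∋ x +ᵥ y → S ∋ x → S ∋ y
    +-cancelˡ-closed {x} {y} Sx+y = +-cancelʳ-closed (subst (S ∋_) (+ᵥ-comm x y) Sx+y)

    lincomb-closed : ∀ {d} (c : Vec Carrier d) (b : Vec (Vect F n) d) →
                     (∀ i → S ∋ Vec.lookup b i) → S ∋ lc c b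
    lincomb-closed []       []       _  = 0∈
    lincomb-closed (c ∷ cs) (v ∷ vs) Sb = +-closed (·-closed c (Sb zero)) (lincomb-closed cs vs (Sb ∘ suc))

  module _ {n : ℕ} {S : Subset F n} where

    isSubspace⇒Subspace : isSubspace F S ≡ true → Subspace S
    isSubspace⇒Subspace e = record
      { 0∈ = 0∈
      ; +-closed = λ {x} {y} Sx Sy → +-closed′ x y Sx Sy (allV-true⁻ _ (allV-true⁻ _ +-closedᵇ x) y)
      ; ·-closed = λ c {x} Sx →
          ·-closed′ c x Sx (allV-true⁻ _ (all-true⁻ _ elements ·-closedᵇ (complete c)) x) }
      where
      0∈ = proj₁ (∧-true⁻ {S 0ᵥ} e)
      closed = proj₂ (∧-true⁻ {S 0ᵥ} e)
      +-closedᵇ = proj₁ (∧-true⁻ {allV F λ x → allV F λ y → not (S x ∧ S y) ∨ S (x +ᵥ y)} closed)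
      ·-closedᵇ = proj₂ (∧-true⁻ {allV F λ x → allV F λ y → not (S x ∧ S y) ∨ S (x +ᵥ y)} closed)
      +-closed′ : ∀ x y → S ∋ x → S ∋ y → not (S x ∧ S y) ∨ S (x +ᵥ y) ≡ true → S ∋ x +ᵥ y
      +-closed′ x y Sx Sy rewrite Sx | Sy = λ h → h
      ·-closed′ : ∀ c x → S ∋ x → not (S x) ∨ S (c ·ᵥ x) ≡ true → S ∋ c ·ᵥ x
      ·-closed′ c x Sx rewrite Sx = λ h → h

    Subspace⇒isSubspace : Subspace S → isSubspace F S ≡ true
    Subspace⇒isSubspace sS = ∧-true⁺ 0∈ (∧-true⁺
      (allV-true⁺ _ λ x → allV-true⁺ _ λ y → +-closedᵇ x y)
      (all-true⁺ _ elements λ {c} _ → allV-true⁺ _ λ x → ·-closedᵇ c x))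
      where
      open Subspace sS
      +-closedᵇ : ∀ x y → not (S x ∧ S y) ∨ S (x +ᵥ y) ≡ true
      +-closedᵇ x y with S x in Sx | S y in Sy
      ... | true  | true  = +-closed Sx Sy
      ... | true  | false = refl
      ... | false | _     = refl
      ·-closedᵇ : ∀ c x → not (S x) ∨ S (c ·ᵥ x) ≡ true
      ·-closedᵇ c x with S x in Sx
      ... | true  = ·-closed c Sx
      ... | false = refl

  ⊕-subspace : ∀ {n} {X Y : Subset F n} → Subspace X → Subspace Y → Subspace (_⊕_ F X Y)
  ⊕-subspace {X = X} {Y} sX sY = record
    { 0∈ = ⊕⁺ X Y X.0∈ Y.0∈ (sym (+ᵥ-identityˡ 0ᵥ))
    ; +-closed = λ h h′ →
        let a , b , Xa , Yb , e = ⊕⁻ X Y h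
            a′ , b′ , Xa′ , Yb′ , e′ = ⊕⁻ X Y h′
        in ⊕⁺ X Y (X.+-closed Xa Xa′) (Y.+-closed Yb Yb′) (trans (cong₂ _+ᵥ_ e e′) (+ᵥ-interchange a b a′ b′))
    ; ·-closed = λ c h →
        let a , b , Xa , Yb , e = ⊕⁻ X Y h
        in ⊕⁺ X Y (X.·-closed c Xa) (Y.·-closed c Yb) (trans (cong (c ·ᵥ_) e) (·ᵥ-distribˡ c a b)) }
    where
    module X = Subspace sX
    module Y = Subspace sY

  ⊑-⊕ˡ : ∀ {n} (X : Subset F n) {Y} → Subspace Y → X ⊑ _⊕_ F X Y
  ⊑-⊕ˡ X {Y} sY {x} Xx = ⊕⁺ X Y Xx (Subspace.0∈ sY) (sym (+ᵥ-identityʳ x))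

  ⊑-⊕ʳ : ∀ {n} {X} (Y : Subset F n) → Subspace X → Y ⊑ _⊕_ F X Y
  ⊑-⊕ʳ {X = X} Y sX {y} Yy = ⊕⁺ X Y (Subspace.0∈ sX) Yy (sym (+ᵥ-identityˡ y))

  ⊕-least : ∀ {n} (X Y : Subset F n) {Z} → Subspace Z → X ⊑ Z → Y ⊑ Z → _⊕_ F X Y ⊑ Z
  ⊕-least X Y {Z} sZ X⊑Z Y⊑Z h = let _ , _ , Xa , Yb , e = ⊕⁻ X Y h in
    subst (Z ∋_) (sym e) (Subspace.+-closed sZ (X⊑Z Xa) (Y⊑Z Yb))

  ⊕-monoʳ : ∀ {n} (X : Subset F n) {Y Z} → Y ⊑ Z → _⊕_ F X Y ⊑ _⊕_ F X Z
  ⊕-monoʳ X {Y} {Z} Y⊑Z h = let _ , _ , Xa , Yb , e = ⊕⁻ X Y h in ⊕⁺ X Z Xa (Y⊑Z Yb) e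

  ⊕-monoˡ : ∀ {n} {X Z} (Y : Subset F n) → X ⊑ Z → _⊕_ F X Y ⊑ _⊕_ F Z Y
  ⊕-monoˡ {X = X} {Z} Y X⊑Z h = let _ , _ , Xa , Yb , e = ⊕⁻ X Y h in ⊕⁺ Z Y (X⊑Z Xa) Yb e

  modular : ∀ {n} (A W T : Subset F n) → Subspace W → A ⊑ W →
            _∩_ F W (_⊕_ F A T) ⊑ _⊕_ F A (_∩_ F W T)
  modular A W T sW A⊑W h =
    let Wv , v∈A⊕T = ∩⁻ W (_⊕_ F A T) h
        a , t , Aa , Tt , v≡ = ⊕⁻ A T v∈A⊕T
        Wt = Subspace.+-cancelˡ-closed sW (subst (W ∋_) v≡ Wv) (A⊑W Aa)
    in ⊕⁺ A (_∩_ F W T) Aa (∩⁺ W T Wt Tt) v≡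

  ∩-⊕-⊑ : ∀ {n} {A W : Subset F n} (T : Subset F n) → Subspace A → Subspace W → A ⊑ W →
          _∩_ F W T ⊑ A → _∩_ F W (_⊕_ F A T) ⊑ A
  ∩-⊕-⊑ {A = A} {W} T sA sW A⊑W W∩T⊑A =
    ⊕-least A (_∩_ F W T) sA (λ Ax → Ax) W∩T⊑A ∘ modular A W T sW A⊑W

  record Join {n} (A W B K : Subset F n) : Set where
    field
      subspace : Subspace K
      lower    : A ⊑ K
      meet     : _∩_ F W K ⊑ A
      upper    : K ⊑ B
      spanning : B ⊑ _⊕_ F W K

  module _ {n : ℕ} {A W B K : Subset F n} where

    inJoin⇒Join : Subspace W → inJoin F A W B K ≡ true → Join A W B K
    inJoin⇒Join sW e = record
      { subspace = isSubspace⇒Subspace sK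
      ; lower    = λ {a} Aa → proj₂ (∩⁻ W K (trans (W∩K≗A a) Aa))
      ; meet     = λ {x} h → trans (sym (W∩K≗A x)) h
      ; upper    = λ {k} Kk → trans (sym (W⊕K≗B k)) (⊑-⊕ʳ K sW Kk)
      ; spanning = λ {x} Bx → trans (W⊕K≗B x) Bx }
      where
      sK : isSubspace F K ≡ true
      sK = proj₁ (∧-true⁻ {isSubspace F K} e)
      equations : _≐_ F (_∩_ F W K) A ∧ _≐_ F (_⊕_ F W K) B ≡ true
      equations = proj₂ (∧-true⁻ {isSubspace F K} e)
      W∩K≗A : _∩_ F W K ≗ A
      W∩K≗A = ≐⇒≗ (_∩_ F W K) A (proj₁ (∧-true⁻ {_≐_ F (_∩_ F W K) A} equations))
      W⊕K≗B : _⊕_ F W K ≗ B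
      W⊕K≗B = ≐⇒≗ (_⊕_ F W K) B (proj₂ (∧-true⁻ {_≐_ F (_∩_ F W K) A} equations))

    Join⇒inJoin : Subspace B → A ⊑ W → W ⊑ B → Join A W B K → inJoin F A W B K ≡ true
    Join⇒inJoin sB A⊑W W⊑B j = ∧-true⁺ (Subspace⇒isSubspace subspace) (∧-true⁺
      (≗⇒≐ (_∩_ F W K) A (⊑-antisym meet λ Aa → ∩⁺ W K (A⊑W Aa) (lower Aa)))
      (≗⇒≐ (_⊕_ F W K) B (⊑-antisym (⊕-least W K sB W⊑B upper) spanning)))
      where open Join j

  module _ {n : ℕ} {K₁ U K₂ T K : Subset F n}
           (sK₁ : Subspace K₁) (sU : Subspace U) (sT : Subspace T) (K₁⊑U : K₁ ⊑ U) where

    join-containing⁻ : Join K₁ U K₂ K × T ⊑ K →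
                       _∩_ F U T ⊑ K₁ × T ⊑ K₂ × Join (_⊕_ F K₁ T) (_⊕_ F U T) K₂ K
    join-containing⁻ (j , T⊑K) = U∩T⊑K₁ , upper ∘ T⊑K , record
      { subspace = subspace
      ; lower    = ⊕-least K₁ T subspace lower T⊑K
      ; meet     = λ h →
          let U⊕Tv , Kv = ∩⁻ (_⊕_ F U T) K h
              a , t , Ua , Tt , v≡ = ⊕⁻ U T U⊕Tv
              Ka = Subspace.+-cancelʳ-closed subspace (subst (K ∋_) v≡ Kv) (T⊑K Tt)
          in ⊕⁺ K₁ T (meet (∩⁺ U K Ua Ka)) Tt v≡
      ; upper    = upper
      ; spanning = ⊕-monoˡ K (⊑-⊕ˡ U sT) ∘ spanning }
      where
      open Join j
      U∩T⊑K₁ : _∩_ F U T ⊑ K₁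
      U∩T⊑K₁ h = let Uv , Tv = ∩⁻ U T h in meet (∩⁺ U K Uv (T⊑K Tv))

    join-containing⁺ : _∩_ F U T ⊑ K₁ × T ⊑ K₂ × Join (_⊕_ F K₁ T) (_⊕_ F U T) K₂ K →
                       Join K₁ U K₂ K × T ⊑ K
    join-containing⁺ (U∩T⊑K₁ , _ , j) = record
      { subspace = subspace
      ; lower    = lower ∘ ⊑-⊕ˡ K₁ sT
      ; meet     = λ h → let Uv , Kv = ∩⁻ U K h in
          ∩-⊕-⊑ T sK₁ sU K₁⊑U U∩T⊑K₁
            (∩⁺ U (_⊕_ F K₁ T) Uv (meet (∩⁺ (_⊕_ F U T) K (⊑-⊕ˡ U sT Uv) Kv)))
      ; upper    = upper
      ; spanning = ⊕-least (_⊕_ F U T) K (⊕-subspace sU subspace)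
                     (⊕-monoʳ U (lower ∘ ⊑-⊕ʳ T sK₁)) (⊑-⊕ʳ K sU) ∘ spanning }
      , lower ∘ ⊑-⊕ʳ T sK₁
      where open Join j

module SubsetEnumeration (F : FiniteField) where
  open Vectors F
  open Subspaces F

  private variable
    n : ℕ

  membership : List (Vect F n) → Subset F n
  membership S x = any (λ y → ⌊ _≟v_ F x y ⌋) S

  ∈⇒membership : ∀ S {v : Vect F n} → v ∈ S → membership S ∋ v
  ∈⇒membership S {v} v∈ = any-true⁺ _ S v∈ (⌊⌋-true⁺ (_≟v_ F v v) refl)

  membership⇒∈ : ∀ S {v : Vect F n} → membership S ∋ v → v ∈ S
  membership⇒∈ S {v} e = let y , y∈ , v≟y = any-true⁻ _ S e in
    subst (_∈ S) (sym (⌊⌋-true⁻ (_≟v_ F v y) v≟y)) y∈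

  ∉⇒membership-false : ∀ S {v : Vect F n} → v ∉ S → membership S v ≡ false
  ∉⇒membership-false S {v} v∉ with membership S v in e
  ... | true  = contradiction (membership⇒∈ S e) v∉
  ... | false = refl

  filterᵇ∈sublists : ∀ {A : Set} (p : A → Bool) xs → filterᵇ p xs ∈ sublists F xs
  filterᵇ∈sublists p []       = here refl
  filterᵇ∈sublists p (x ∷ xs) with p x
  ... | true  = ∈-++⁺ʳ (sublists F xs) (∈-map⁺ (x ∷_) (filterᵇ∈sublists p xs))
  ... | false = ∈-++⁺ˡ (filterᵇ∈sublists p xs)

  sublist-⊆ : ∀ {A : Set} (xs : List A) {s} → s ∈ sublists F xs → ∀ {y} → y ∈ s → y ∈ xs
  sublist-⊆ []       (here refl) ()
  sublist-⊆ (x ∷ xs) s∈ y∈ with ∈-++⁻ (sublists F xs) s∈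
  ... | inj₁ s∈′ = there (sublist-⊆ xs s∈′ y∈)
  ... | inj₂ s∈′ with ∈-map⁻ (x ∷_) s∈′
  ...   | _ , s′∈ , refl with y∈
  ...     | here refl = here refl
  ...     | there y∈′ = there (sublist-⊆ xs s′∈ y∈′)

  allSubsets-complete : (K : Subset F n) → Σ (Subset F n) λ K′ → K′ ∈ allSubsets F n × K ≗ K′
  allSubsets-complete {n} K = membership listed , ∈-map⁺ membership (filterᵇ∈sublists K (enumV F n)) ,
    λ v → true-ext (λ Kv → ∈⇒membership listed (∈-filterᵇ⁺ K (enumV F n) (∈-enumV v) Kv))
                   (λ e → proj₂ (∈-filterᵇ⁻ K (enumV F n) (membership⇒∈ listed e)))
    where listed = filterᵇ K (enumV F n)

  sublists-distinct : ∀ (E : List (Vect F n)) → AllPairs _≢_ E →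
                      AllPairs (λ s s′ → ¬ membership s ≗ membership s′) (sublists F E)
  sublists-distinct []       []          = All.[] ∷ []
  sublists-distinct (x ∷ xs) (x≢ ∷ xs≢) = AllPairs.++⁺ IH
    (AllPairs.map⁺ (AllPairs-map-∈ (sublists F xs) cons-distinct IH))
    (All.tabulate λ s∈ → All.tabulate λ w∈ → without≉with s∈ w∈)
    where
    IH = sublists-distinct xs xs≢
    x∉ : ∀ {s} → s ∈ sublists F xs → x ∉ s
    x∉ s∈ x∈ = All.lookup x≢ (sublist-⊆ xs s∈ x∈) refl
    cons-distinct : ∀ {s s′} → s ∈ sublists F xs → s′ ∈ sublists F xs →
                    ¬ membership s ≗ membership s′ → ¬ membership (x ∷ s) ≗ membership (x ∷ s′)
    cons-distinct {s} {s′} s∈ s′∈ s≉s′ x∷s≈x∷s′ = s≉s′ s≈s′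
      where
      s≈s′ : membership s ≗ membership s′
      s≈s′ v with _≟v_ F v x | x∷s≈x∷s′ v
      ... | no _     | e = e
      ... | yes refl | _ = trans (∉⇒membership-false s (x∉ s∈)) (sym (∉⇒membership-false s′ (x∉ s′∈)))
    without≉with : ∀ {s w} → s ∈ sublists F xs → w ∈ map (x ∷_) (sublists F xs) →
                   ¬ membership s ≗ membership w
    without≉with {s} s∈ w∈ s≈w with ∈-map⁻ (x ∷_) w∈
    ... | s′ , _ , refl = contradiction
      (trans (sym (∉⇒membership-false s (x∉ s∈))) (trans (s≈w x) (∈⇒membership (x ∷ s′) (here refl))))
      λ ()

  allSubsets-distinct : AllPairs (λ K K′ → ¬ K ≗ K′) (allSubsets F n)
  allSubsets-distinct {n} = AllPairs.map⁺ (sublists-distinct (enumV F n) (enumV-distinct n))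

module Dimension (F : FiniteField) where
  open FiniteField F using (Carrier; 0#; 1#; _≟_; inverse; isCommutativeRing)
  open IsCommutativeRing isCommutativeRing using (*-comm)
  open Vectors F
  open Subspaces F

  IndependentModulo : ∀ {n c} → Subset F n → Vec (Vect F n) c → Set
  IndependentModulo S x = ∀ m → S ∋ lc m x → m ≡ 0ᵥ

  SpanningModulo : ∀ {n c} → Subset F n → Subset F n → Vec (Vect F n) c → Set
  SpanningModulo {c = c} W S x = ∀ w → W ∋ w → Σ (Vect F c) λ m → S ∋ w +ᵥ lc m x

  record QuotientBasis {n} (W S : Subset F n) (c : ℕ) : Set where
    field
      vectors     : Vec (Vect F n) c
      ∈W          : ∀ i → W ∋ Vec.lookup vectors i
      independent : IndependentModulo S vectors
      spanning    : SpanningModulo W S vectors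

  module _ {n : ℕ} {S : Subset F n} (sS : Subspace S) where
    private module S = Subspace sS

    independentModulo⇒≤ : ∀ {c} {x : Vec (Vect F n) c} → IndependentModulo S x → c ≤ n
    independentModulo⇒≤ {x = x} independent =
      injective⇒≤ (λ m → lc m x)
        (lincomb-injective x λ m lc≡0 → independent m (subst (S ∋_) (sym lc≡0) S.0∈))

    dim-≤ : ∀ {d d′} (b : Vec (Vect F n) d) (b′ : Vec (Vect F n) d′) →
            (∀ i → S ∋ Vec.lookup b i) → LinearlyIndependent b →
            (∀ x → S ∋ x → Σ (Vect F d′) λ c → x ≡ lc c b′) → d ≤ d′
    dim-≤ {d} {d′} b b′ ∈S independent spanning = injective⇒≤ coordinates coordinates-injective
      where
      coordinates : Vect F d → Vect F d′
      coordinates c = proj₁ (spanning (lc c b) (S.lincomb-closed c b ∈S))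
      coordinates-injective : ∀ c c′ → coordinates c ≡ coordinates c′ → c ≡ c′
      coordinates-injective c c′ e = lincomb-injective b independent c c′
        (trans (proj₂ (spanning (lc c b) (S.lincomb-closed c b ∈S)))
          (trans (cong (λ z → lc z b′) e) (sym (proj₂ (spanning (lc c′ b) (S.lincomb-closed c′ b ∈S))))))

    dim-unique : ∀ {d d′} → HasDim F S d → HasDim F S d′ → d ≡ d′
    dim-unique (b , ∈S , indep , span) (b′ , ∈S′ , indep′ , span′) =
      ℕ.≤-antisym (dim-≤ b b′ ∈S indep span′) (dim-≤ b′ b ∈S′ indep′ span)

    independentModulo-∷ : ∀ {c v} {x : Vec (Vect F n) c} → IndependentModulo S x →
                          (∀ m → ¬ S ∋ v +ᵥ lc m x) → IndependentModulo S (v ∷ x)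
    independentModulo-∷ independent unreachable (m₀ ∷ m) h with m₀ ≟ 0#
    ... | yes refl = cong (0# ∷_)
      (independent m (subst (S ∋_) (trans (cong (_+ᵥ _) (·ᵥ-zeroˡ _)) (+ᵥ-identityˡ _)) h))
    independentModulo-∷ {v = v} {x} independent unreachable (m₀ ∷ m) h | no m₀≢0 =
      contradiction (subst (S ∋_) scaled (S.·-closed m₀⁻¹ h)) (unreachable (m₀⁻¹ ·ᵥ m))
      where
      m₀⁻¹ = proj₁ (inverse m₀ m₀≢0)
      scaled : m₀⁻¹ ·ᵥ (m₀ ·ᵥ v +ᵥ lc m x) ≡ v +ᵥ lc (m₀⁻¹ ·ᵥ m) x
      scaled = trans (·ᵥ-distribˡ m₀⁻¹ _ _) (cong₂ _+ᵥ_
        (trans (sym (·ᵥ-assoc m₀⁻¹ m₀ v))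
          (trans (cong (_·ᵥ v) (trans (*-comm m₀⁻¹ m₀) (proj₂ (inverse m₀ m₀≢0)))) (·ᵥ-identityˡ v)))
        (sym (lincomb-·ᵥ m₀⁻¹ m x)))

  module _ {n : ℕ} {S W : Subset F n} (sS : Subspace S) where
    private
      reachable : ∀ {c} → Vec (Vect F n) c → Vect F n → Bool
      reachable {c} x v = any (λ m → S (v +ᵥ lc m x)) (enumV F c)

      -- greedy extension; the fuel suffices as a family independent modulo S has at most n vectors
      extend : ∀ k {c} (x : Vec (Vect F n) c) → (∀ i → W ∋ Vec.lookup x i) → IndependentModulo S x →
               n < k + c → Σ ℕ (QuotientBasis W S)
      extend zero {c} x ∈W independent n<c = contradiction (independentModulo⇒≤ sS independent) (ℕ.<⇒≱ n<c)
      extend (suc k) {c} x ∈W independent n<k+c with anyV F (λ v → W v ∧ not (reachable x v)) in e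
      ... | false = c , record { vectors = x ; ∈W = ∈W ; independent = independent ; spanning = spanning }
        where
        spanning : SpanningModulo W S x
        spanning w Ww with reachable x w in r
        ... | true = let m , _ , h = any-true⁻ _ (enumV F c) r in m , h
        ... | false = contradiction (trans (sym (anyV-true⁺ _ w (∧-true⁺ Ww (cong not r)))) e) λ ()
      ... | true = extend k (v ∷ x) ∈W′ (independentModulo-∷ sS independent unreachable)
                          (subst (n <_) (sym (ℕ.+-suc k c)) n<k+c)
        where
        witness : Σ (Vect F n) λ v → W v ∧ not (reachable x v) ≡ true
        witness = anyV-true⁻ (λ v → W v ∧ not (reachable x v)) e
        v : Vect F n
        v = proj₁ witness
        Wv : W ∋ v
        Wv = proj₁ (∧-true⁻ {W v} (proj₂ witness))
        unreachable : ∀ m → ¬ S ∋ v +ᵥ lc m x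
        unreachable m h = contradiction (any-true⁺ _ (enumV F c) (∈-enumV m) h)
          λ r → contradiction (trans (sym (cong not r)) (proj₂ (∧-true⁻ {W v} (proj₂ witness)))) λ ()
        ∈W′ : ∀ i → W ∋ Vec.lookup (v ∷ x) i
        ∈W′ zero    = Wv
        ∈W′ (suc i) = ∈W i

    quotientBasis-exists : Σ ℕ (QuotientBasis W S)
    quotientBasis-exists = extend (suc n) [] (λ ()) (λ { [] _ → refl }) (ℕ.m≤m+n (suc n) zero)

  module _ {n : ℕ} {S W : Subset F n} (sS : Subspace S) (S⊑W : S ⊑ W) where
    private module S = Subspace sS

    hasDim-++ : ∀ {s c} → HasDim F S s → QuotientBasis W S c → HasDim F W (s + c)
    hasDim-++ {s} (b , ∈S , b-independent , b-spanning) q =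
      b ++ x , ∈W′ , independent′ , spanning′
      where
      open QuotientBasis q renaming (vectors to x; ∈W to x∈W)
      ∈W′ : ∀ i → W ∋ Vec.lookup (b ++ x) i
      ∈W′ = VecAll.lookup⁺ {P = W ∋_}
              (VecAll.++⁺ (VecAll.lookup⁻ {xs = b} (S⊑W ∘ ∈S)) (VecAll.lookup⁻ {xs = x} x∈W))
      independent′ : LinearlyIndependent (b ++ x)
      independent′ coeff lc≡0 with Vec.splitAt s coeff
      ... | c₁ , c₂ , refl = trans (cong₂ _++_ c₁≡0 c₂≡0) (0ᵥ++0ᵥ s)
        where
        sum≡0 : lc c₁ b +ᵥ lc c₂ x ≡ 0ᵥ
        sum≡0 = trans (sym (lincomb-++ c₁ c₂ b x)) lc≡0
        c₂≡0 : c₂ ≡ 0ᵥ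
        c₂≡0 = independent c₂ (subst (S ∋_) (sym (inverseʳ-unique _ _ sum≡0))
                 (S.neg-closed (S.lincomb-closed c₁ b ∈S)))
        c₁≡0 : c₁ ≡ 0ᵥ
        c₁≡0 = b-independent c₁ (begin
          lc c₁ b              ≡⟨ sym (+ᵥ-identityʳ _) ⟩
          lc c₁ b +ᵥ 0ᵥ        ≡⟨ cong (lc c₁ b +ᵥ_) (trans (sym (lincomb-0ᵥ x)) (cong (λ z → lc z x) (sym c₂≡0))) ⟩
          lc c₁ b +ᵥ lc c₂ x   ≡⟨ sum≡0 ⟩
          0ᵥ                   ∎)
          where open ≡-Reasoning
      spanning′ : ∀ w → W ∋ w → Σ (Vect F (s + _)) λ coeff → w ≡ lc coeff (b ++ x)
      spanning′ w Ww =
        let m , w+x∈S = spanning w Ww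
            c₁ , w+x≡ = b-spanning _ w+x∈S
        in c₁ ++ negᵥ m , (begin
          w                                ≡⟨ sym (+ᵥ--ᵥ-cancel (lc m x) w) ⟩
          (w +ᵥ lc m x) -ᵥ lc m x          ≡⟨ cong (_-ᵥ lc m x) w+x≡ ⟩
          lc c₁ b +ᵥ negᵥ (lc m x)         ≡⟨ cong (lc c₁ b +ᵥ_) (sym (lincomb-negᵥ m x)) ⟩
          lc c₁ b +ᵥ lc (negᵥ m) x         ≡⟨ sym (lincomb-++ c₁ (negᵥ m) b x) ⟩
          lc (c₁ ++ negᵥ m) (b ++ x)       ∎)
        where open ≡-Reasoning

    quotientBasis-size : ∀ {s w c} → Subspace W → HasDim F S s → HasDim F W w →
                         QuotientBasis W S c → c ≡ w ∸ s
    quotientBasis-size {s} {c = c} sW dimS dimW q =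
      trans (sym (ℕ.m+n∸m≡n s c)) (cong (_∸ s) (dim-unique sW (hasDim-++ dimS q) dimW))

  quotientBasis-⊕ : ∀ {n} {K₁ U : Subset F n} (T : Subset F n) {c} →
                    Subspace K₁ → Subspace U → Subspace T → K₁ ⊑ U → _∩_ F U T ⊑ K₁ →
                    QuotientBasis U K₁ c → QuotientBasis (_⊕_ F U T) (_⊕_ F K₁ T) c
  quotientBasis-⊕ {K₁ = K₁} {U} T sK₁ sU sT K₁⊑U U∩T⊑K₁ q = record
    { vectors     = vectors
    ; ∈W          = ⊑-⊕ˡ U sT ∘ ∈W
    ; independent = λ m h → independent m
        (∩-⊕-⊑ T sK₁ sU K₁⊑U U∩T⊑K₁ (∩⁺ U (_⊕_ F K₁ T) (Subspace.lincomb-closed sU m vectors ∈W) h))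
    ; spanning    = λ w h →
        let a , t , Ua , Tt , w≡ = ⊕⁻ U T h
            m , a+x∈K₁ = spanning a Ua
        in m , ⊕⁺ K₁ T a+x∈K₁ Tt (trans (cong (_+ᵥ lc m vectors) w≡) (+ᵥ-comm-middle a t _)) }
    where open QuotientBasis q

module JoinCounting (F : FiniteField) where
  open FiniteField F using (order)
  open Vectors F
  open Subspaces F
  open Dimension F
  open SubsetEnumeration F

  Join-resp-≗ : ∀ {n} {A W B K K′ : Subset F n} → Join A W B K → K ≗ K′ → Join A W B K′
  Join-resp-≗ {W = W} {K = K} {K′} j K≗K′ = record
    { subspace = record
      { 0∈       = to 0∈
      ; +-closed = λ Kx Ky → to (+-closed (from Kx) (from Ky))
      ; ·-closed = λ c → to ∘ ·-closed c ∘ from }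
    ; lower    = to ∘ lower
    ; meet     = λ h → let Wx , K′x = ∩⁻ W K′ h in meet (∩⁺ W K Wx (from K′x))
    ; upper    = upper ∘ from
    ; spanning = ⊕-monoʳ W to ∘ spanning }
    where
    open Join j
    open Subspace subspace
    to : K ⊑ K′
    to {x} Kx = trans (sym (K≗K′ x)) Kx
    from : K′ ⊑ K
    from {x} K′x = trans (K≗K′ x) K′x

  infixl 6 _+⟨_⟩

  _+⟨_⟩ : ∀ {n e} → Subset F n → Vec (Vect F n) e → Subset F n
  (A +⟨ z ⟩) v = any (λ p → A (v +ᵥ lc p z)) (enumV F _)

  module _ {n e} (A : Subset F n) (z : Vec (Vect F n) e) where

    +⟨⟩⁻ : ∀ {v} → A +⟨ z ⟩ ∋ v → Σ (Vect F e) λ p → A ∋ v +ᵥ lc p z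
    +⟨⟩⁻ h = let p , _ , Ap = any-true⁻ _ (enumV F e) h in p , Ap

    +⟨⟩⁺ : ∀ {v} p → A ∋ v +ᵥ lc p z → A +⟨ z ⟩ ∋ v
    +⟨⟩⁺ p = any-true⁺ _ (enumV F e) (∈-enumV p)

    module _ (sA : Subspace A) where
      private module A = Subspace sA

      ⊑-+⟨⟩ : A ⊑ A +⟨ z ⟩
      ⊑-+⟨⟩ {v} Av = +⟨⟩⁺ 0ᵥ (subst (A ∋_) (sym (trans (cong (v +ᵥ_) (lincomb-0ᵥ z)) (+ᵥ-identityʳ v))) Av)

      lincomb∈+⟨⟩ : ∀ p → A +⟨ z ⟩ ∋ lc p z
      lincomb∈+⟨⟩ p = +⟨⟩⁺ (negᵥ p)
        (subst (A ∋_) (sym (trans (cong (lc p z +ᵥ_) (lincomb-negᵥ p z)) (negᵥ-inverseʳ _))) A.0∈)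

      +⟨⟩-subspace : Subspace (A +⟨ z ⟩)
      +⟨⟩-subspace = record
        { 0∈ = ⊑-+⟨⟩ A.0∈
        ; +-closed = λ {v} {v′} h h′ →
            let p , Ap = +⟨⟩⁻ h ; p′ , Ap′ = +⟨⟩⁻ h′ in
            +⟨⟩⁺ (p +ᵥ p′) (subst (A ∋_)
              (trans (+ᵥ-interchange v _ v′ _) (cong (v +ᵥ v′ +ᵥ_) (sym (lincomb-+ᵥ p p′ z))))
              (A.+-closed Ap Ap′))
        ; ·-closed = λ a {v} h →
            let p , Ap = +⟨⟩⁻ h in
            +⟨⟩⁺ (a ·ᵥ p) (subst (A ∋_)
              (trans (·ᵥ-distribˡ a v _) (cong (a ·ᵥ v +ᵥ_) (sym (lincomb-·ᵥ a p z))))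
              (A.·-closed a Ap)) }

  module _ {n c e} {A W B : Subset F n} (sA : Subspace A) (sW : Subspace W) (sB : Subspace B)
           (A⊑W : A ⊑ W) (W⊑B : W ⊑ B) (X : QuotientBasis W A c) (Y : QuotientBasis B W e) where
    open QuotientBasis X using ()
      renaming (vectors to x; ∈W to x∈W; independent to x-independent; spanning to x-spanning)
    open QuotientBasis Y using ()
      renaming (vectors to y; ∈W to y∈B; independent to y-independent; spanning to y-spanning)
    private
      module W = Subspace sW
      module B = Subspace sB

    Matrix : Set
    Matrix = Vec (Vect F c) e

    graph : Matrix → Vec (Vect F n) e
    graph M = Vec.zipWith _+ᵥ_ y (Vec.map (λ r → lc r x) M)

    lincomb-graph : ∀ p M → lc p (graph M) ≡ lc p y +ᵥ lc (lc p M) x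
    lincomb-graph p M = trans (lincomb-zipWith p y _) (cong (lc p y +ᵥ_) (sym (lincomb-lincomb p M x)))

    lookup-graph : ∀ M j → Vec.lookup (graph M) j ≡ Vec.lookup y j +ᵥ lc (Vec.lookup M j) x
    lookup-graph M j = trans (Vecₚ.lookup-zipWith _+ᵥ_ j y _) (cong (Vec.lookup y j +ᵥ_) (Vecₚ.lookup-map j _ M))

    lincomb-x∈W : ∀ m → W ∋ lc m x
    lincomb-x∈W m = W.lincomb-closed m x x∈W

    lincomb-graph∈B : ∀ p M → B ∋ lc p (graph M)
    lincomb-graph∈B p M = subst (B ∋_) (sym (lincomb-graph p M))
      (B.+-closed (B.lincomb-closed p y y∈B) (W⊑B (lincomb-x∈W (lc p M))))

    joinOf : Matrix → Subset F n
    joinOf M = A +⟨ graph M ⟩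

    graph-row∈joinOf : ∀ M j → joinOf M ∋ Vec.lookup y j +ᵥ lc (Vec.lookup M j) x
    graph-row∈joinOf M j = subst (joinOf M ∋_) (trans (lincomb-unit j (graph M)) (lookup-graph M j))
                        (lincomb∈+⟨⟩ A (graph M) sA (unit j))

    joinOf-isJoin : ∀ M → Join A W B (joinOf M)
    joinOf-isJoin M = record
      { subspace = +⟨⟩-subspace A g sA
      ; lower    = ⊑-+⟨⟩ A g sA
      ; meet     = meet
      ; upper    = λ h → let p , Ap = +⟨⟩⁻ A g h in
                     B.+-cancelʳ-closed (W⊑B (A⊑W Ap)) (lincomb-graph∈B p M)
      ; spanning = λ {v} Bv → let p , W∋v+py = y-spanning v Bv in
          ⊕⁺ W (joinOf M) (subst (W ∋_) (v+lincomb-graph p) (W.+-closed W∋v+py (lincomb-x∈W (lc p M))))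
            (Subspace.neg-closed (+⟨⟩-subspace A g sA) (lincomb∈+⟨⟩ A g sA p))
            (sym (+ᵥ--ᵥ-cancel (lc p g) v)) }
      where
      g : Vec (Vect F n) e
      g = graph M
      v+lincomb-graph : ∀ {v} p → (v +ᵥ lc p y) +ᵥ lc (lc p M) x ≡ v +ᵥ lc p g
      v+lincomb-graph {v} p = trans (+ᵥ-assoc v _ _) (cong (v +ᵥ_) (sym (lincomb-graph p M)))
      -- for v ∈ W, the y-coefficients p must vanish
      meet : _∩_ F W (joinOf M) ⊑ A
      meet {v} h =
        let Wv , joinOf∋v = ∩⁻ W (joinOf M) h
            p , Ap = +⟨⟩⁻ A g joinOf∋v
            W∋py = W.+-cancelʳ-closed (subst (W ∋_) (lincomb-graph p M) (W.+-cancelˡ-closed (A⊑W Ap) Wv))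
                                      (lincomb-x∈W (lc p M))
        in subst (A ∋_) (trans (cong (λ q → v +ᵥ lc q g) (y-independent p W∋py))
                               (trans (cong (v +ᵥ_) (lincomb-0ᵥ g)) (+ᵥ-identityʳ v))) Ap

    row-unique : ∀ {K} → Join A W B K → ∀ j {m m′} →
                 K ∋ Vec.lookup y j +ᵥ lc m x → K ∋ Vec.lookup y j +ᵥ lc m′ x → m ≡ m′
    row-unique {K} j-K j {m} {m′} h h′ = x∙y⁻¹≈ε⇒x≈y m m′ (x-independent (m -ᵥ m′) (meet (∩⁺ W K
      (lincomb-x∈W (m -ᵥ m′)) (subst (K ∋_) difference (Subspace.-ᵥ-closed subspace h h′)))))
      where
      open Join j-K
      difference : (Vec.lookup y j +ᵥ lc m x) -ᵥ (Vec.lookup y j +ᵥ lc m′ x) ≡ lc (m -ᵥ m′) x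
      difference = trans (+ᵥ--ᵥ-+ᵥ _ _ _) (sym (lincomb--ᵥ m m′ x))

    -- the default 0ᵥ is never returned for a member of the join, by row-exists
    row : Subset F n → Fin e → Vect F c
    row K j = first (λ m → K (Vec.lookup y j +ᵥ lc m x)) 0ᵥ (enumV F c)

    matrixOf : Subset F n → Matrix
    matrixOf K = Vec.tabulate (row K)

    matrixOf-cong : ∀ {K K′} → K ≗ K′ → matrixOf K ≡ matrixOf K′
    matrixOf-cong K≗K′ = Vecₚ.tabulate-cong λ j → first-cong 0ᵥ (enumV F c) (λ m → K≗K′ _)

    matrixOf-joinOf : ∀ M → matrixOf (joinOf M) ≡ M
    matrixOf-joinOf M = trans (Vecₚ.tabulate-cong row-joinOf) (Vecₚ.tabulate∘lookup M)
      where
      row-joinOf : ∀ j → row (joinOf M) j ≡ Vec.lookup M j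
      row-joinOf j = row-unique (joinOf-isJoin M) j
        (first-satisfies (λ m → joinOf M (Vec.lookup y j +ᵥ lc m x)) 0ᵥ (enumV F c)
          (∈-enumV (Vec.lookup M j)) (graph-row∈joinOf M j))
        (graph-row∈joinOf M j)

    row-exists : ∀ {K} → Join A W B K → ∀ j → Σ (Vect F c) λ m → K ∋ Vec.lookup y j +ᵥ lc m x
    row-exists {K} j-K j with ⊕⁻ W K (Join.spanning j-K (y∈B j))
    ... | w , k , Ww , Kk , yⱼ≡w+k with x-spanning w Ww
    ...   | m , A∋w+mx =
      m , subst (K ∋_) rearrange (Subspace.+-closed (Join.subspace j-K) (Join.lower j-K A∋w+mx) Kk)
      where
      rearrange : (w +ᵥ lc m x) +ᵥ k ≡ Vec.lookup y j +ᵥ lc m x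
      rearrange = trans (sym (+ᵥ-comm-middle w k _)) (cong (_+ᵥ lc m x) (sym yⱼ≡w+k))
    graph-matrixOf∈ : ∀ {K} → Join A W B K → ∀ j → K ∋ Vec.lookup (graph (matrixOf K)) j
    graph-matrixOf∈ {K} j-K j = subst (K ∋_) (sym (trans (lookup-graph (matrixOf K) j)
      (cong (λ r → Vec.lookup y j +ᵥ lc r x) (Vecₚ.lookup∘tabulate (row K) j))))
      (first-satisfies (λ m → K (Vec.lookup y j +ᵥ lc m x)) 0ᵥ (enumV F c)
        (∈-enumV (proj₁ (row-exists j-K j))) (proj₂ (row-exists j-K j)))

    join≗joinOf : ∀ {K} M → Join A W B K → (∀ j → K ∋ Vec.lookup (graph M) j) → K ≗ joinOf M
    join≗joinOf {K} M j-K graph∈K = ⊑-antisym K⊑joinOf joinOf⊑K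
      where
      open Join j-K
      module K = Subspace subspace
      g : Vec (Vect F n) e
      g = graph M
      K∋pg : ∀ p → K ∋ lc p g
      K∋pg p = K.lincomb-closed p g graph∈K
      K⊑joinOf : K ⊑ joinOf M
      K⊑joinOf {v} Kv = let p , W∋v+py = y-spanning v (upper Kv) in
        +⟨⟩⁺ A g p (meet (∩⁺ W K
          (subst (W ∋_) (trans (+ᵥ-assoc v _ _) (cong (v +ᵥ_) (sym (lincomb-graph p M))))
            (W.+-closed W∋v+py (lincomb-x∈W (lc p M))))
          (K.+-closed Kv (K∋pg p))))
      joinOf⊑K : joinOf M ⊑ K
      joinOf⊑K h = let p , Ap = +⟨⟩⁻ A g h in K.+-cancelʳ-closed (lower Ap) (K∋pg p)

    join-count : length (join F A W B) ≡ order ^ (c * e)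
    join-count = trans
      (length-≡-by-inverses (Setoid.isEquivalence (Vect F n →-setoid Bool)) (join F A W B) (vecs (enumV F c) e)
        (AllPairs.filter⁺ (T? ∘ inJoin F A W B) allSubsets-distinct)
        (vecs-distinct (enumV F c) (enumV-distinct c) e)
        matrixOf joinOf matrixOf-cong (λ _ → ∈-vecs (enumV F c) ∈-enumV _) joinOf∈joins matrixOf-joinOf
        (λ {K} K∈ → join≗joinOf (matrixOf K) (isJoin K∈) (graph-matrixOf∈ (isJoin K∈))))
      (trans (length-vecs (enumV F c) e) (trans (cong (_^ e) (length-enumV c)) (ℕ.^-*-assoc order c e)))
      where
      isJoin : ∀ {K} → K ∈ join F A W B → Join A W B K
      isJoin K∈ = inJoin⇒Join sW (proj₂ (∈-filterᵇ⁻ _ (allSubsets F n) K∈))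
      joinOf∈joins : ∀ {M} → M ∈ vecs (enumV F c) e →
                     Σ (Subset F n) λ K → K ∈ join F A W B × joinOf M ≗ K
      joinOf∈joins {M} _ = let K , K∈ , joinOf≗K = allSubsets-complete (joinOf M) in
        K , ∈-filterᵇ⁺ _ (allSubsets F n) K∈
              (Join⇒inJoin sB A⊑W W⊑B (Join-resp-≗ (joinOf-isJoin M) joinOf≗K)) ,
        joinOf≗K

module JoinsContaining (F : FiniteField) {n : ℕ} {K₁ U K₂ T : Subset F n}
  (sK₁ : Subspaces.Subspace F K₁) (sU : Subspaces.Subspace F U)
  (sK₂ : Subspaces.Subspace F K₂) (sT : Subspaces.Subspace F T)
  (K₁⊑U : Subspaces._⊑_ F K₁ U) (U⊑K₂ : Subspaces._⊑_ F U K₂) where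
  open FiniteField F using (order)
  open Subspaces F
  open Dimension F
  open JoinCounting F

  inJoin-containing : (K : Subset F n) →
    ((inJoin F K₁ U K₂ K ≡ true) × (_⊆_ F T K ≡ true))
    ⇔ ((_⊆_ F (_∩_ F U T) K₁ ≡ true) × (_⊆_ F T K₂ ≡ true)
       × (inJoin F (_⊕_ F K₁ T) (_⊕_ F U T) K₂ K ≡ true))
  inJoin-containing K = mk⇔
    (λ (inJ , T⊆K) →
      let U∩T⊑K₁ , T⊑K₂ , j = join-containing⁻ sK₁ sU sT K₁⊑U (inJoin⇒Join sU inJ , ⊆⇒⊑ T K T⊆K) in
      ⊑⇒⊆ (_∩_ F U T) K₁ U∩T⊑K₁ , ⊑⇒⊆ T K₂ T⊑K₂ ,
      Join⇒inJoin sK₂ (⊕-monoˡ T K₁⊑U) (⊕-least U T sK₂ U⊑K₂ T⊑K₂) j)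
    (λ (U∩T⊆K₁ , T⊆K₂ , inJ) →
      let j , T⊑K = join-containing⁺ sK₁ sU sT K₁⊑U
                      (⊆⇒⊑ (_∩_ F U T) K₁ U∩T⊆K₁ , ⊆⇒⊑ T K₂ T⊆K₂ , inJoin⇒Join (⊕-subspace sU sT) inJ) in
      Join⇒inJoin sK₂ K₁⊑U U⊑K₂ j , ⊑⇒⊆ T K T⊑K)

  conditions : Bool
  conditions = _⊆_ F (_∩_ F U T) K₁ ∧ _⊆_ F T K₂

  inJoin∧⊆≡conditions∧inJoin : ∀ K → inJoin F K₁ U K₂ K ∧ _⊆_ F T K
                                     ≡ conditions ∧ inJoin F (_⊕_ F K₁ T) (_⊕_ F U T) K₂ K
  inJoin∧⊆≡conditions∧inJoin K = true-ext
    (λ e → let a , b , c = Equivalence.to (inJoin-containing K) (∧-true⁻ e) in ∧-true⁺ (∧-true⁺ a b) c)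
    (λ e → let ab , c = ∧-true⁻ {conditions} e ; a , b = ∧-true⁻ ab in
           let i , t = Equivalence.from (inJoin-containing K) (a , b , c) in ∧-true⁺ i t)

  module _ {u k₁ k̄₂ r} (dimU : HasDim F U u) (dimK₁ : HasDim F K₁ k₁)
           (dimK₂ : HasDim F K₂ (u + k̄₂)) (dimU⊕T : HasDim F (_⊕_ F U T) (u + r)) where

    length-join-⊕ : conditions ≡ true →
                    length (join F (_⊕_ F K₁ T) (_⊕_ F U T) K₂) ≡ order ^ ((u ∸ k₁) * (k̄₂ ∸ r))
    length-join-⊕ e = trans
      (join-count (⊕-subspace sK₁ sT) sU⊕T sK₂ (⊕-monoˡ T K₁⊑U) U⊕T⊑K₂
        (quotientBasis-⊕ T sK₁ sU sT K₁⊑U U∩T⊑K₁ X) Y)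
      (cong (order ^_) (cong₂ _*_
        (quotientBasis-size sK₁ K₁⊑U sU dimK₁ dimU X)
        (trans (quotientBasis-size sU⊕T U⊕T⊑K₂ sK₂ dimU⊕T dimK₂ Y) (ℕ.[m+n]∸[m+o]≡n∸o u k̄₂ r))))
      where
      U∩T⊑K₁ : _∩_ F U T ⊑ K₁
      U∩T⊑K₁ = ⊆⇒⊑ (_∩_ F U T) K₁ (proj₁ (∧-true⁻ e))
      U⊕T⊑K₂ : _⊕_ F U T ⊑ K₂
      U⊕T⊑K₂ = ⊕-least U T sK₂ U⊑K₂ (⊆⇒⊑ T K₂ (proj₂ (∧-true⁻ e)))
      sU⊕T : Subspace (_⊕_ F U T)
      sU⊕T = ⊕-subspace sU sT
      X : QuotientBasis U K₁ _
      X = proj₂ (quotientBasis-exists sK₁)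
      Y : QuotientBasis K₂ (_⊕_ F U T) _
      Y = proj₂ (quotientBasis-exists sU⊕T)

    λ-join : lam F T (join F K₁ U K₂) ≡ (if conditions then order ^ ((u ∸ k₁) * (k̄₂ ∸ r)) else 0)
    λ-join = begin
      length (filterᵇ (_⊆_ F T) (join F K₁ U K₂))
        ≡⟨ cong length (filterᵇ-filterᵇ (inJoin F K₁ U K₂) (_⊆_ F T) (allSubsets F n)) ⟩
      length (filterᵇ (λ K → inJoin F K₁ U K₂ K ∧ _⊆_ F T K) (allSubsets F n))
        ≡⟨ cong length (filterᵇ-cong (allSubsets F n) inJoin∧⊆≡conditions∧inJoin) ⟩
      length (filterᵇ (λ K → conditions ∧ inJoin F (_⊕_ F K₁ T) (_⊕_ F U T) K₂ K) (allSubsets F n))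
        ≡⟨ by-cases conditions refl ⟩
      (if conditions then order ^ ((u ∸ k₁) * (k̄₂ ∸ r)) else 0) ∎
      where
      open ≡-Reasoning
      by-cases : ∀ b → conditions ≡ b →
        length (filterᵇ (λ K → b ∧ inJoin F (_⊕_ F K₁ T) (_⊕_ F U T) K₂ K) (allSubsets F n))
          ≡ (if b then order ^ ((u ∸ k₁) * (k̄₂ ∸ r)) else 0)
      by-cases false _ = cong length (filterᵇ-false (allSubsets F n))
      by-cases true  e = length-join-⊕ e

lemma4p9 : (F : FiniteField) (n : ℕ) (K₁ U K₂ T : Subset F n) →
    isSubspace F K₁ ≡ true → isSubspace F U ≡ true → isSubspace F K₂ ≡ true → isSubspace F T ≡ true →
    _⊆_ F K₁ U ≡ true → _⊆_ F U K₂ ≡ true →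
    ((K : Subset F n) →
    ((inJoin F K₁ U K₂ K ≡ true) × (_⊆_ F T K ≡ true))
    ⇔ ((_⊆_ F (_∩_ F U T) K₁ ≡ true) × (_⊆_ F T K₂ ≡ true)
    × (inJoin F (_⊕_ F K₁ T) (_⊕_ F U T) K₂ K ≡ true)))
    × ((u k₁ k̄₂ r : ℕ) →
    HasDim F U u → HasDim F K₁ k₁ → HasDim F K₂ (u + k̄₂) → HasDim F (_⊕_ F U T) (u + r) →
    lam F T (join F K₁ U K₂)
    ≡ (if _⊆_ F (_∩_ F U T) K₁ ∧ _⊆_ F T K₂
    then FiniteField.order F ^ ((u ∸ k₁) * (k̄₂ ∸ r)) else 0))
lemma4p9 F n K₁ U K₂ T K₁-sub U-sub K₂-sub T-sub K₁⊆U U⊆K₂ =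
  inJoin-containing , λ _ _ _ _ → λ-join
  where
  open Subspaces F
  open JoinsContaining F (isSubspace⇒Subspace {S = K₁} K₁-sub) (isSubspace⇒Subspace {S = U} U-sub)
    (isSubspace⇒Subspace {S = K₂} K₂-sub) (isSubspace⇒Subspace {S = T} T-sub)
    (⊆⇒⊑ K₁ U K₁⊆U) (⊆⇒⊑ U K₂ U⊆K₂)
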